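{- Let $k\ge 2$ and let $l^i_{k,n}$ ($1\le i\le k$, $n\in\mathbb{Z}$) be the $k$ sequences of generalized order-$k$ Lucas numbers defined in the context. Then for every integer $n$, $$l^i_{k,n}=\begin{cases} l^k_{k,n-1} & \text{if } i=1,\\ \sum_{m=1}^{i} l^k_{k,n-m} & \text{if } 1<i<k,\\ l^k_{k,n} & \text{if } i=k.\end{cases}$$
   Context: For $1\le i\le k$ and $1-k\le n\le 0$: $l^i_{k,n}=-i$ if $i-n<k$, $l^i_{k,n}=i-2n$ if $i-n=k$, $l^i_{k,n}=k-i-1$ if $i-n>k$; and $l^i_{k,n}=\sum_{j=1}^k l^i_{k,n-j}$ for $n\ge 1$. Each sequence is extended to all integers $n$ by requiring the recurrence $l^i_{k,n}=\sum_{j=1}^k l^i_{k,n-j}$ for all $n\in\mathbb{Z}$ (i.e. $l^i_{k,n-k}=l^i_{k,n}-\sum_{j=1}^{k-1}l^i_{k,n-j}$). -}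

module Defs where

open import Data.Nat as ℕ using (ℕ; zero; suc; _<?_)
open import Data.Integer as ℤ using (ℤ; +_; -[1+_]; _+_; _-_; -_)
open import Relation.Nullary using (yes; no)

sumFrom : (ℕ → ℤ) → ℕ → ℕ → ℤ
sumFrom f a zero    = + 0
sumFrom f a (suc c) = f a + sumFrom f (suc a) c

-- Initial values l^i_{k,n} for 1-k ≤ n ≤ 0, written with n = -j (0 ≤ j ≤ k-1):
--   i - n < k  : -i ;  i - n = k : i - 2n ;  i - n > k : k - i - 1
initVal : (k i j : ℕ) → ℤ
initVal k i j with (i ℕ.+ j) ℕ.<? k | k ℕ.<? (i ℕ.+ j)
... | yes _ | _     = - (+ i)
... | no _  | yes _ = (+ k) - (+ i) - (+ 1)
... | no _  | no _  = (+ i) + (+ (2 ℕ.* j))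

-- A window at position n: w j = l_{n-j} for 0 ≤ j < k (values at j ≥ k unused).
Window : Set
Window = ℕ → ℤ

window0 : (k i : ℕ) → Window
window0 k i j = initVal k i j

-- from the window at n to the window at n+1 : l_{n+1} = Σ_{j=1}^k l_{n+1-j}
stepF : ℕ → Window → Window
stepF k w zero    = sumFrom w 0 k
stepF k w (suc j) = w j

-- from the window at n to the window at n-1 :
-- l_{n-k} = l_n - Σ_{j=1}^{k-1} l_{n-j}
stepB : ℕ → Window → Window
stepB k w j with suc j ℕ.<? k
... | yes _ = w (suc j)
... | no _  = w 0 - sumFrom w 1 (k ℕ.∸ 1)

iter : (Window → Window) → ℕ → Window → Window
iter s zero    w = w
iter s (suc m) w = s (iter s m w)

windowAt : (k i : ℕ) → ℤ → Window
windowAt k i (+ m)    = iter (stepF k) m (window0 k i)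
windowAt k i -[1+ m ] = iter (stepB k) (suc m) (window0 k i)

-- l^i_{k,n} for n ∈ ℤ (the unique bi-infinite extension satisfying the recurrence)
lucas : (k i : ℕ) → ℤ → ℤ
lucas k i n = windowAt k i n 0

sumPrev : (k : ℕ) → ℤ → ℕ → ℤ
sumPrev k n c = sumFrom (λ m → lucas k k (n - + m)) 1 c

-- The heart of the proof is the shift relation
--     l^{i+1}_{k,n} = l^i_{k,n-1} + l^k_{k,n-1}        (0 ≤ i < k, n ∈ ℤ)
-- together with l^0_{k,n} = 0; induction on i then gives
--     l^i_{k,n} = Σ_{m=1}^{i} l^k_{k,n-m}               (0 ≤ i ≤ k),
-- and the three cases of the theorem are the instances i = 1, 1 < i < k, i = k.
--
-- The sequences are computed through windows (the k consecutive values ending at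
-- n), moved forward by stepF and backward by stepB.  Both steps are linear, and
-- stepB undoes stepF, so the linear map `transport n` carrying the window at 0 to
-- the window at n satisfies transport (n+1) = transport n ∘ stepF.  Hence it
-- suffices to verify the shift relation once, on the initial windows, where it is
-- an explicit computation with the piecewise initial values (sections 1 and 3).
module Submission where

open import Defs
open import Data.Nat using (ℕ; _≤_; _<_)
open import Data.Integer using (ℤ; +_; _-_)
open import Data.Product using (_×_)
open import Relation.Binary.PropositionalEquality using (_≡_)

import Data.Nat as ℕ
open import Data.Nat using (zero; suc; z≤n; s≤s; _<?_)
import Data.Nat.Properties as ℕP
open import Data.Integer using (-[1+_]; _+_; -_; _*_)
import Data.Integer.Properties as ℤP
open import Data.Integer.Tactic.RingSolver using (solve-∀)
open import Algebra.Properties.CommutativeSemigroup ℤP.+-commutativeSemigroup using (interchange)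
open import Data.Product using (_,_)
open import Data.Empty using (⊥-elim)
open import Relation.Nullary using (yes; no)
open import Relation.Binary.Definitions using (tri<; tri≈; tri>)
open import Relation.Binary.PropositionalEquality
  using (refl; sym; trans; cong; cong₂; subst; module ≡-Reasoning)

open ≡-Reasoning

-- 1. Finite sums  sumFrom f a c = f a + f (a+1) + … + f (a+c-1)

sum-cong : ∀ f g a c → (∀ j → a ≤ j → j < a ℕ.+ c → f j ≡ g j) →
           sumFrom f a c ≡ sumFrom g a c
sum-cong f g a zero    eq = refl
sum-cong f g a (suc c) eq =
  cong₂ _+_ (eq a ℕP.≤-refl (ℕP.m<m+n a (s≤s z≤n)))
            (sum-cong f g (suc a) c λ j a<j j<end →
               eq j (ℕP.<⇒≤ a<j) (subst (j <_) (sym (ℕP.+-suc a c)) j<end))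

sum-+ : ∀ f g a c → sumFrom (λ j → f j + g j) a c ≡ sumFrom f a c + sumFrom g a c
sum-+ f g a zero    = refl
sum-+ f g a (suc c) =
  trans (cong (_+_ (f a + g a)) (sum-+ f g (suc a) c)) (interchange (f a) (g a) _ _)

sum-shift : ∀ f a c → sumFrom f (suc a) c ≡ sumFrom (λ j → f (suc j)) a c
sum-shift f a zero    = refl
sum-shift f a (suc c) = cong (_+_ (f (suc a))) (sum-shift f (suc a) c)

sum-snoc : ∀ f a c → sumFrom f a (suc c) ≡ sumFrom f a c + f (a ℕ.+ c)
sum-snoc f a zero    = begin
  f a + + 0      ≡⟨ ℤP.+-identityʳ (f a) ⟩
  f a            ≡⟨ cong f (sym (ℕP.+-identityʳ a)) ⟩
  f (a ℕ.+ 0)    ≡⟨ sym (ℤP.+-identityˡ _) ⟩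
  + 0 + f (a ℕ.+ 0) ∎
sum-snoc f a (suc c) = begin
  f a + sumFrom f (suc a) (suc c)           ≡⟨ cong (_+_ (f a)) (sum-snoc f (suc a) c) ⟩
  f a + (sumFrom f (suc a) c + f (suc a ℕ.+ c))
    ≡⟨ sym (ℤP.+-assoc (f a) _ _) ⟩
  f a + sumFrom f (suc a) c + f (suc a ℕ.+ c)
    ≡⟨ cong (λ x → f a + sumFrom f (suc a) c + f x) (sym (ℕP.+-suc a c)) ⟩
  f a + sumFrom f (suc a) c + f (a ℕ.+ suc c) ∎

sum-split : ∀ f a c d → sumFrom f a (c ℕ.+ d) ≡ sumFrom f a c + sumFrom f (a ℕ.+ c) d
sum-split f a zero    d =
  trans (cong (λ x → sumFrom f x d) (sym (ℕP.+-identityʳ a))) (sym (ℤP.+-identityˡ _))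
sum-split f a (suc c) d = begin
  f a + sumFrom f (suc a) (c ℕ.+ d)
    ≡⟨ cong (_+_ (f a)) (sum-split f (suc a) c d) ⟩
  f a + (sumFrom f (suc a) c + sumFrom f (suc a ℕ.+ c) d)
    ≡⟨ sym (ℤP.+-assoc (f a) _ _) ⟩
  f a + sumFrom f (suc a) c + sumFrom f (suc a ℕ.+ c) d
    ≡⟨ cong (λ x → f a + sumFrom f (suc a) c + sumFrom f x d) (sym (ℕP.+-suc a c)) ⟩
  f a + sumFrom f (suc a) c + sumFrom f (a ℕ.+ suc c) d ∎

sum-const : ∀ f v a c → (∀ j → a ≤ j → j < a ℕ.+ c → f j ≡ v) → sumFrom f a c ≡ + c * v
sum-const f v a c eq = trans (sum-cong f (λ _ → v) a c eq) (constant a c)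
  where
  constant : ∀ a c → sumFrom (λ _ → v) a c ≡ + c * v
  constant a zero    = refl
  constant a (suc c) = trans (cong (_+_ v) (constant (suc a) c)) (one-more v (+ c))
    where
    one-more : ∀ (v c : ℤ) → v + c * v ≡ (+ 1 + c) * v
    one-more = solve-∀

-- A sum of d + 1 + e terms whose summand equals a on the first d terms, b on the
-- next one and c on the last e terms; this is the shape of the initial values.
sum-piecewise : ∀ f (a b c : ℤ) d e →
  (∀ j → j < d → f j ≡ a) → f d ≡ b → (∀ j → d < j → j < suc (d ℕ.+ e) → f j ≡ c) →
  sumFrom f 0 (d ℕ.+ suc e) ≡ + d * a + (b + + e * c)
sum-piecewise f a b c d e below at above = begin
  sumFrom f 0 (d ℕ.+ suc e)                    ≡⟨ sum-split f 0 d (suc e) ⟩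
  sumFrom f 0 d + (f d + sumFrom f (suc d) e)
    ≡⟨ cong₂ _+_ (sum-const f a 0 d λ j _ → below j)
                 (cong₂ _+_ at (sum-const f c (suc d) e above)) ⟩
  + d * a + (b + + e * c)                      ∎

-- 2. Windows and linear steps

-- Windows only carry meaning in their first k entries.
_≈[_]_ : Window → ℕ → Window → Set
w ≈[ k ] v = ∀ j → j < k → w j ≡ v j

infix 4 _≈[_]_

≈-sym : ∀ {k w v} → w ≈[ k ] v → v ≈[ k ] w
≈-sym w≈v j j<k = sym (w≈v j j<k)

≈-trans : ∀ {k u v w} → u ≈[ k ] v → v ≈[ k ] w → u ≈[ k ] w
≈-trans u≈v v≈w j j<k = trans (u≈v j j<k) (v≈w j j<k)

≡⇒≈ : ∀ {k w v} → w ≡ v → w ≈[ k ] v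
≡⇒≈ refl _ _ = refl

_⊕_ : Window → Window → Window
(w ⊕ v) j = w j + v j

zeroW : Window
zeroW _ = + 0

record Linear (k : ℕ) (s : Window → Window) : Set where
  field
    resp     : ∀ {w v} → w ≈[ k ] v → s w ≈[ k ] s v
    additive : ∀ w v → s (w ⊕ v) ≈[ k ] (s w ⊕ s v)

open Linear

-- An additive map sends zero to zero, since s 0 = s (0 ⊕ 0) = s 0 + s 0.
linear-zero : ∀ {k s} → Linear k s → ∀ w → w ≈[ k ] zeroW → s w ≈[ k ] zeroW
linear-zero {k} {s} lin w w≈0 j j<k =
  trans (resp lin w≈0 j j<k) (doubling-zero (s zeroW j) (additive lin zeroW zeroW j j<k))
  where
  doubling-zero : ∀ x → x ≡ x + x → x ≡ + 0
  doubling-zero x x≡2x = begin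
    x              ≡⟨ cancel x ⟩
    (x + x) - x    ≡⟨ cong (_- x) (sym x≡2x) ⟩
    x - x          ≡⟨ ℤP.+-inverseʳ x ⟩
    + 0            ∎
    where
    cancel : ∀ (x : ℤ) → x ≡ (x + x) - x
    cancel = solve-∀

iter-comm : ∀ s m (w : Window) → iter s m (s w) ≡ s (iter s m w)
iter-comm s zero    w = refl
iter-comm s (suc m) w = cong s (iter-comm s m w)

iter-linear : ∀ {k s} → Linear k s → ∀ m → Linear k (iter s m)
iter-linear lin zero    = record { resp = λ w≈v → w≈v ; additive = λ _ _ _ _ → refl }
iter-linear lin (suc m) = record
  { resp     = λ w≈v → resp lin (resp (iter-linear lin m) w≈v)
  ; additive = λ w v → ≈-trans (resp lin (additive (iter-linear lin m) w v)) (additive lin _ _)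
  }

stepF-linear : ∀ k → Linear k (stepF k)
stepF-linear k = record { resp = resp′ ; additive = additive′ }
  where
  resp′ : ∀ {w v} → w ≈[ k ] v → stepF k w ≈[ k ] stepF k v
  resp′ {w} {v} w≈v zero    _   = sum-cong w v 0 k λ j _ j<k → w≈v j j<k
  resp′         w≈v (suc j) j<k = w≈v j (ℕP.<-trans (ℕP.n<1+n j) j<k)
  additive′ : ∀ w v → stepF k (w ⊕ v) ≈[ k ] (stepF k w ⊕ stepF k v)
  additive′ w v zero    _ = sum-+ w v 0 k
  additive′ w v (suc j) _ = refl

-- The summation range 1 ≤ j < 1 + (k - 1) of stepB lies inside the window.
k∸1-bound : ∀ {k} → 0 < k → ∀ {j} → j < suc (k ℕ.∸ 1) → j < k
k∸1-bound {suc k} _ j<k = j<k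

stepB-linear : ∀ k → Linear k (stepB k)
stepB-linear k = record { resp = resp′ ; additive = additive′ }
  where
  resp′ : ∀ {w v} → w ≈[ k ] v → stepB k w ≈[ k ] stepB k v
  resp′ {w} {v} w≈v j j<k with suc j <? k
  ... | yes 1+j<k = w≈v (suc j) 1+j<k
  ... | no _      = cong₂ _-_ (w≈v 0 0<k)
                      (sum-cong w v 1 (k ℕ.∸ 1) λ i _ i<k → w≈v i (k∸1-bound 0<k i<k))
    where
    0<k : 0 < k
    0<k = ℕP.<-≤-trans (s≤s z≤n) j<k
  additive′ : ∀ w v → stepB k (w ⊕ v) ≈[ k ] (stepB k w ⊕ stepB k v)
  additive′ w v j j<k with suc j <? k
  ... | yes _ = refl
  ... | no _  = trans (cong (_-_ (w 0 + v 0)) (sum-+ w v 1 (k ℕ.∸ 1)))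
                      (regroup (w 0) (v 0) _ _)
    where
    regroup : ∀ (a b s t : ℤ) → (a + b) - (s + t) ≡ (a - s) + (b - t)
    regroup = solve-∀

-- Stepping backwards undoes stepping forwards: the only new entry of
-- stepB (stepF w) is  Σ_{j<k} w j − Σ_{j<k-1} w j = w (k-1).
stepB∘stepF : ∀ k w → stepB k (stepF k w) ≈[ k ] w
stepB∘stepF k w j j<k with suc j <? k
... | yes _   = refl
... | no 1+j≮k =
  subst (λ k → sumFrom w 0 k - sumFrom (stepF k w) 1 (k ℕ.∸ 1) ≡ w j)
        (ℕP.≤-antisym j<k (ℕP.≮⇒≥ 1+j≮k)) last-entry
  where
  drop-sum : ∀ (s x : ℤ) → (s + x) - s ≡ x
  drop-sum = solve-∀
  last-entry : sumFrom w 0 (suc j) - sumFrom (stepF (suc j) w) 1 j ≡ w j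
  last-entry = trans (cong₂ _-_ (sum-snoc w 0 j) (sum-shift (stepF (suc j) w) 0 j))
                     (drop-sum (sumFrom w 0 j) (w j))

transport : ℕ → ℤ → Window → Window
transport k (+ m)    = iter (stepF k) m
transport k -[1+ m ] = iter (stepB k) (suc m)

transport-linear : ∀ k n → Linear k (transport k n)
transport-linear k (+ m)    = iter-linear (stepF-linear k) m
transport-linear k -[1+ m ] = iter-linear (stepB-linear k) (suc m)

lucas-transport : ∀ k i n → lucas k i n ≡ transport k n (window0 k i) 0
lucas-transport k i (+ m)    = refl
lucas-transport k i -[1+ m ] = refl

forward-back : ∀ k m w → iter (stepB k) (suc m) (stepF k w) ≈[ k ] iter (stepB k) m w
forward-back k m w =
  ≈-trans (≡⇒≈ (sym (iter-comm (stepB k) m (stepF k w))))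
          (resp (iter-linear (stepB-linear k) m) (stepB∘stepF k w))

transport-suc : ∀ k n w → transport k (n + + 1) w ≈[ k ] transport k n (stepF k w)
transport-suc k (+ m)        w = ≡⇒≈ (begin
  iter (stepF k) (m ℕ.+ 1) w     ≡⟨ cong (λ m → iter (stepF k) m w) (ℕP.+-comm m 1) ⟩
  stepF k (iter (stepF k) m w)   ≡⟨ sym (iter-comm (stepF k) m w) ⟩
  iter (stepF k) m (stepF k w)   ∎)
transport-suc k -[1+ zero ]  w = ≈-sym (forward-back k 0 w)
transport-suc k -[1+ suc m ] w = ≈-sym (forward-back k (suc m) w)

-- 3. The initial values l^i_{k,-j} = initVal k i j

initVal-below : ∀ k i j → i ℕ.+ j < k → initVal k i j ≡ - + i
initVal-below k i j lt with i ℕ.+ j <? k | k <? i ℕ.+ j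
... | yes _ | _ = refl
... | no ≮  | _ = ⊥-elim (≮ lt)

initVal-at : ∀ k i j → i ℕ.+ j ≡ k → initVal k i j ≡ + i + + (2 ℕ.* j)
initVal-at k i j eq with i ℕ.+ j <? k | k <? i ℕ.+ j
... | yes lt | _      = ⊥-elim (ℕP.<-irrefl eq lt)
... | no _   | yes gt = ⊥-elim (ℕP.<-irrefl (sym eq) gt)
... | no _   | no _   = refl

initVal-above : ∀ k i j → k < i ℕ.+ j → initVal k i j ≡ + k - + i - + 1
initVal-above k i j gt with i ℕ.+ j <? k | k <? i ℕ.+ j
... | yes lt | _    = ⊥-elim (ℕP.<-asym lt gt)
... | no _   | yes _ = refl
... | no _   | no ≯ = ⊥-elim (≯ gt)

initVal-top : ∀ k j → initVal k k (suc j) ≡ - + 1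
initVal-top k j = trans (initVal-above k k (suc j) (ℕP.m<m+n k (s≤s z≤n))) (minus-one (+ k))
  where
  minus-one : ∀ (K : ℤ) → K - K - + 1 ≡ - + 1
  minus-one = solve-∀

-- l^{i+1}_{k,-j} = l^i_{k,-j-1} - 1: both sides fall into the same case, because
-- (i+1) + j = i + (j+1).
initVal-suc : ∀ k i j → initVal k (suc i) j ≡ initVal k i (suc j) - + 1
initVal-suc k i j with ℕP.<-cmp (suc i ℕ.+ j) k
... | tri< lt _ _ = begin
  initVal k (suc i) j      ≡⟨ initVal-below k (suc i) j lt ⟩
  - (+ 1 + + i)            ≡⟨ below-id (+ i) ⟩
  - + i - + 1              ≡⟨ cong (λ x → x - + 1) (sym (initVal-below k i (suc j) (subst (_< k) (sym (ℕP.+-suc i j)) lt))) ⟩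
  initVal k i (suc j) - + 1 ∎
  where
  below-id : ∀ (I : ℤ) → - (+ 1 + I) ≡ - I - + 1
  below-id = solve-∀
... | tri≈ _ eq _ = begin
  initVal k (suc i) j                ≡⟨ initVal-at k (suc i) j eq ⟩
  + 1 + + i + + (2 ℕ.* j)           ≡⟨ cong (_+_ (+ 1 + + i)) (ℤP.pos-* 2 j) ⟩
  + 1 + + i + + 2 * + j             ≡⟨ at-id (+ i) (+ j) ⟩
  + i + + 2 * (+ 1 + + j) - + 1     ≡⟨ cong (λ x → + i + x - + 1) (sym (ℤP.pos-* 2 (suc j))) ⟩
  + i + + (2 ℕ.* suc j) - + 1       ≡⟨ cong (λ x → x - + 1) (sym (initVal-at k i (suc j) (trans (ℕP.+-suc i j) eq))) ⟩
  initVal k i (suc j) - + 1 ∎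
  where
  at-id : ∀ (I J : ℤ) → + 1 + I + + 2 * J ≡ I + + 2 * (+ 1 + J) - + 1
  at-id = solve-∀
... | tri> _ _ gt = begin
  initVal k (suc i) j            ≡⟨ initVal-above k (suc i) j gt ⟩
  + k - (+ 1 + + i) - + 1        ≡⟨ above-id (+ k) (+ i) ⟩
  + k - + i - + 1 - + 1          ≡⟨ cong (λ x → x - + 1) (sym (initVal-above k i (suc j) (subst (k <_) (sym (ℕP.+-suc i j)) gt))) ⟩
  initVal k i (suc j) - + 1 ∎
  where
  above-id : ∀ (K I : ℤ) → K - (+ 1 + I) - + 1 ≡ K - I - + 1 - + 1
  above-id = solve-∀

-- With k = d + i and i ≥ 1, the initial values l^i_{k,-j} (0 ≤ j < k) are -i
-- for j < d, then i + 2d, then k - i - 1; they add up to d + 1 = k - i + 1.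
initVal-sum : ∀ d i → sumFrom (initVal (d ℕ.+ suc i) (suc i)) 0 (d ℕ.+ suc i) ≡ + suc d
initVal-sum d i = begin
  sumFrom (initVal k (suc i)) 0 k
    ≡⟨ sum-piecewise (initVal k (suc i)) _ _ _ d i below at above ⟩
  + d * - + suc i + (+ suc i + + (2 ℕ.* d) + + i * (+ k - + suc i - + 1))
    ≡⟨ cong₂ (λ x y → + d * - + suc i + (+ suc i + x + + i * (y - + suc i - + 1)))
             (ℤP.pos-* 2 d) (ℤP.pos-+ d (suc i)) ⟩
  + d * - (+ 1 + + i) + (+ 1 + + i + + 2 * + d + + i * (+ d + (+ 1 + + i) - (+ 1 + + i) - + 1))
    ≡⟨ total (+ d) (+ i) ⟩
  + 1 + + d ∎
  where
  k : ℕ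
  k = d ℕ.+ suc i
  i+d≡k : suc i ℕ.+ d ≡ k
  i+d≡k = ℕP.+-comm (suc i) d
  below : ∀ j → j < d → initVal k (suc i) j ≡ - + suc i
  below j j<d = initVal-below k (suc i) j (subst (suc i ℕ.+ j <_) i+d≡k (ℕP.+-monoʳ-< (suc i) j<d))
  at : initVal k (suc i) d ≡ + suc i + + (2 ℕ.* d)
  at = initVal-at k (suc i) d i+d≡k
  above : ∀ j → d < j → j < suc (d ℕ.+ i) → initVal k (suc i) j ≡ + k - + suc i - + 1
  above j d<j _ = initVal-above k (suc i) j (subst (_< suc i ℕ.+ j) i+d≡k (ℕP.+-monoʳ-< (suc i) d<j))
  total : ∀ (D I : ℤ) →
    D * - (+ 1 + I) + (+ 1 + I + + 2 * D + I * (D + (+ 1 + I) - (+ 1 + I) - + 1)) ≡ + 1 + D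
  total = solve-∀

initial-shift : ∀ k i → suc i ≤ k → stepF k (window0 k (suc i)) ≈[ k ] (window0 k i ⊕ window0 k k)
initial-shift k i i<k zero    _ =
  subst (λ k → sumFrom (initVal k (suc i)) 0 k ≡ initVal k i 0 + initVal k k 0)
        (ℕP.m∸n+n≡m i<k) (first-entry (k ℕ.∸ suc i))
  where
  first-entry : ∀ d → sumFrom (initVal (d ℕ.+ suc i) (suc i)) 0 (d ℕ.+ suc i)
                      ≡ initVal (d ℕ.+ suc i) i 0 + initVal (d ℕ.+ suc i) (d ℕ.+ suc i) 0
  first-entry d = begin
    sumFrom (initVal K (suc i)) 0 K     ≡⟨ initVal-sum d i ⟩
    + 1 + + d                           ≡⟨ value (+ d) (+ i) ⟩
    - + i + (+ d + + suc i + + 0)       ≡⟨ cong (λ x → - + i + (x + + 0)) (sym (ℤP.pos-+ d (suc i))) ⟩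
    - + i + (+ K + + 0)                 ≡⟨ sym (cong₂ _+_ (initVal-below K i 0 i+0<K) (initVal-at K K 0 (ℕP.+-identityʳ K))) ⟩
    initVal K i 0 + initVal K K 0       ∎
    where
    K : ℕ
    K = d ℕ.+ suc i
    i+0<K : i ℕ.+ 0 < K
    i+0<K = subst (_< K) (sym (ℕP.+-identityʳ i)) (ℕP.<-≤-trans (ℕP.n<1+n i) (ℕP.m≤n+m (suc i) d))
    value : ∀ (D I : ℤ) → + 1 + D ≡ - I + (D + (+ 1 + I) + + 0)
    value = solve-∀
initial-shift k i i<k (suc j) _ =
  trans (initVal-suc k i j) (cong (_+_ (initVal k i (suc j))) (sym (initVal-top k j)))

-- 4. The shift relation and the vanishing of l^0

lucas-shift : ∀ k i → suc i ≤ k → ∀ n → lucas k (suc i) (n + + 1) ≡ lucas k i n + lucas k k n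
lucas-shift k i i<k n = begin
  lucas k (suc i) (n + + 1)                     ≡⟨ lucas-transport k (suc i) (n + + 1) ⟩
  transport k (n + + 1) (window0 k (suc i)) 0   ≡⟨ transport-suc k n _ 0 0<k ⟩
  T (stepF k (window0 k (suc i))) 0             ≡⟨ resp linear (initial-shift k i i<k) 0 0<k ⟩
  T (window0 k i ⊕ window0 k k) 0               ≡⟨ additive linear _ _ 0 0<k ⟩
  T (window0 k i) 0 + T (window0 k k) 0         ≡⟨ sym (cong₂ _+_ (lucas-transport k i n) (lucas-transport k k n)) ⟩
  lucas k i n + lucas k k n                     ∎
  where
  T : Window → Window
  T = transport k n
  linear : Linear k T
  linear = transport-linear k n
  0<k : 0 < k
  0<k = ℕP.<-≤-trans (s≤s z≤n) i<k

-- l^0_{k,n} = 0: its initial values vanish and transport is linear.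
lucas-zero : ∀ k → 0 < k → ∀ n → lucas k 0 n ≡ + 0
lucas-zero k 0<k n =
  trans (lucas-transport k 0 n)
        (linear-zero (transport-linear k n) (window0 k 0) (initVal-below k 0) 0 0<k)

-- 5. The sum formula and the theorem

sumPrev-suc : ∀ k n c → sumPrev k n (suc c) ≡ lucas k k (n - + 1) + sumPrev k (n - + 1) c
sumPrev-suc k n c = cong (_+_ (lucas k k (n - + 1))) (begin
  sumFrom (λ m → lucas k k (n - + m)) 2 c
    ≡⟨ sum-shift (λ m → lucas k k (n - + m)) 1 c ⟩
  sumFrom (λ m → lucas k k (n - + suc m)) 1 c
    ≡⟨ sum-cong _ _ 1 c (λ m _ _ → cong (lucas k k) (shift n (+ m))) ⟩
  sumFrom (λ m → lucas k k (n - + 1 - + m)) 1 c ∎)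
  where
  shift : ∀ (n m : ℤ) → n - (+ 1 + m) ≡ n - + 1 - m
  shift = solve-∀

lucas-sumPrev : ∀ k i → 0 < k → i ≤ k → ∀ n → lucas k i n ≡ sumPrev k n i
lucas-sumPrev k zero    0<k _   n = lucas-zero k 0<k n
lucas-sumPrev k (suc i) 0<k i<k n = begin
  lucas k (suc i) n                              ≡⟨ cong (lucas k (suc i)) (sym (n-1+1 n)) ⟩
  lucas k (suc i) (n - + 1 + + 1)                ≡⟨ lucas-shift k i i<k (n - + 1) ⟩
  lucas k i (n - + 1) + lucas k k (n - + 1)      ≡⟨ cong (λ x → x + lucas k k (n - + 1)) (lucas-sumPrev k i 0<k (ℕP.<⇒≤ i<k) (n - + 1)) ⟩
  sumPrev k (n - + 1) i + lucas k k (n - + 1)    ≡⟨ ℤP.+-comm (sumPrev k (n - + 1) i) _ ⟩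
  lucas k k (n - + 1) + sumPrev k (n - + 1) i    ≡⟨ sym (sumPrev-suc k n i) ⟩
  sumPrev k n (suc i)                            ∎
  where
  n-1+1 : ∀ (n : ℤ) → n - + 1 + + 1 ≡ n
  n-1+1 = solve-∀

lemma2p9 : (k : ℕ) → 2 ≤ k → (n : ℤ) →
    (lucas k 1 n ≡ lucas k k (n - + 1))
    × ((i : ℕ) → 1 < i → i < k → lucas k i n ≡ sumPrev k n i)
    × (lucas k k n ≡ lucas k k n)
lemma2p9 k 2≤k n = first , middle , refl
  where
  0<k : 0 < k
  0<k = ℕP.<-trans (s≤s z≤n) 2≤k
  first : lucas k 1 n ≡ lucas k k (n - + 1)
  first = trans (lucas-sumPrev k 1 0<k (ℕP.<⇒≤ 2≤k) n) (ℤP.+-identityʳ _)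
  middle : (i : ℕ) → 1 < i → i < k → lucas k i n ≡ sumPrev k n i
  middle i _ i<k = lucas-sumPrev k i 0<k (ℕP.<⇒≤ i<k) n
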